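{- Let $r\in\mathbb N$ with $r>1$ and let $\mathbb G=(G,\le)$ be an ordered graph. Let $uLv$ be an $(r,\mathbb G)$-chain of length $t$ in $G$. Then there exists a unique set of $(r,\mathbb G)$-admissible paths $\{v_{i-1}L'_iv_i\}_{i=1}^{t'}$ such that $uLv=v_0L'_1v_1\,L'_2\,v_2\cdots v_{t'-1}L'_{t'}v_{t'}$ (with $v_0=u$ and $v_{t'}=v$).
   Context: An ordered graph is a pair $\mathbb G=(G,\le)$ with $G$ a simple undirected graph and $\le$ a total order on $V(G)$. Paths are simple; $xPy$ denotes a path from $x$ to $y$ with internal vertex sequence $P$. A path $vPx$ is $\mathbb G$-admissible if $x<v$ and every internal vertex $w$ satisfies $w>v$; it is $(r,\mathbb G)$-admissible ($r$-admissible) if in addition its length is at most $r$. A path $uLv$ is a $\mathbb G$-chain if every vertex of the path other than $v$ is $>v$. A $\mathbb G$-chain is an $(r,\mathbb G)$-chain if it has no $\mathbb G$-admissible subpath of length strictly greater than $r$. -}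

module Defs where

open import Level using (Level; _⊔_; suc)
open import Data.Nat using (ℕ; _≤_) renaming (suc to sucℕ)
open import Data.List using (List; []; _∷_; _++_; _∷ʳ_; length; reverse; concat)
open import Data.List.Relation.Unary.All using (All)
open import Data.List.Relation.Unary.Linked using (Linked)
open import Data.List.Relation.Unary.Unique.Propositional using (Unique)
open import Data.Product using (Σ; ∃; ∃-syntax; _×_)
open import Data.Sum using (_⊎_)
open import Data.Unit.Polymorphic using (⊤)
open import Relation.Binary.Core using (Rel)
open import Relation.Binary.Definitions using (Symmetric; Irreflexive)
open import Relation.Binary.Structures using (IsStrictTotalOrder)
open import Relation.Binary.PropositionalEquality using (_≡_)

record OrderedGraph (a ℓ₁ ℓ₂ : Level) : Set (suc (a ⊔ ℓ₁ ⊔ ℓ₂)) where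
  field
    V      : Set a
    E      : Rel V ℓ₁
    E-sym  : Symmetric E
    E-irr  : Irreflexive _≡_ E
    _<_    : Rel V ℓ₂
    <-isStrictTotalOrder : IsStrictTotalOrder _≡_ _<_

module _ {a ℓ₁ ℓ₂} (𝔾 : OrderedGraph a ℓ₁ ℓ₂) where
  open OrderedGraph 𝔾

  -- A path is given by its (nonempty) list of vertices in order:
  -- consecutive vertices adjacent, all vertices distinct.
  -- Its length is the number of edges, i.e. (number of vertices) - 1.
  IsPath : List V → Set (a ⊔ ℓ₁)
  IsPath ws = Linked E ws × Unique ws

  Admissible : List V → Set (a ⊔ ℓ₁ ⊔ ℓ₂)
  Admissible ws =
    ∃[ v ] ∃[ P ] ∃[ x ] (ws ≡ v ∷ (P ∷ʳ x)) × IsPath ws × (x < v) × All (v <_) P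

  -- (r,G)-admissible: admissible of length (#edges) at most r,
  -- i.e. at most r + 1 vertices.
  RAdmissible : ℕ → List V → Set (a ⊔ ℓ₁ ⊔ ℓ₂)
  RAdmissible r ws = Admissible ws × length ws ≤ sucℕ r

  Segment : List V → List V → Set a
  Segment ws L = ∃[ α ] ∃[ β ] L ≡ α ++ ws ++ β

  Subpath : List V → List V → Set a
  Subpath ws L = Segment ws L ⊎ Segment (reverse ws) L

  Chain : V → V → List V → Set (a ⊔ ℓ₁ ⊔ ℓ₂)
  Chain u v ws = IsPath ws × ∃[ init ] (ws ≡ init ∷ʳ v) × All (v <_) init
                 × ∃[ ys ] ws ≡ u ∷ ys

  -- (r,G)-chain: a G-chain with no G-admissible subpath of length > r,
  -- i.e. with more than r + 1 vertices.
  RChain : ℕ → V → V → List V → Set (a ⊔ ℓ₁ ⊔ ℓ₂)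
  RChain r u v ws = Chain u v ws
    × (∀ qs → Subpath qs ws → Admissible qs → length qs ≤ sucℕ r)

  lastOf : V → List V → V
  lastOf s []      = s
  lastOf s (y ∷ τ) = lastOf y τ

  -- A sequence of (r,G)-admissible paths v₀L'₁v₁, v₁L'₂v₂, …, starting at s.
  -- Each path is given by its vertex list after its first vertex (its
  -- first vertex is the last vertex of the previous path, resp. s).
  -- The concatenation v₀L'₁v₁L'₂v₂⋯ then has vertex list s ∷ concat τs.
  AdmSeq : ℕ → V → List (List V) → Set (a ⊔ ℓ₁ ⊔ ℓ₂)
  AdmSeq r s []       = ⊤
  AdmSeq r s (τ ∷ τs) = RAdmissible r (s ∷ τ) × AdmSeq r (lastOf s τ) τs

{-# OPTIONS --safe #-}
-- A piece of the decomposition that starts at s has its interior above s and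
-- its end below s, so it must end at the first vertex after s lying below s:
-- the pieces are forced one after the other. Cutting greedily there always
-- succeeds on a chain, because its last vertex v lies below all others (so
-- there is a vertex below s until v is reached) and its vertices are distinct
-- (so every other vertex is comparable to s strictly). Each piece is a segment
-- of the chain, hence a path, hence admissible, hence of length at most r.
module Submission where

open import Defs
open import Data.Nat using (ℕ; _<_; suc)
open import Data.List using (List; _∷_; concat; length)
open import Data.Product using (∃-syntax; _×_)
open import Relation.Binary.PropositionalEquality using (_≡_)

open import Level using (_⊔_)
open import Data.Empty using (⊥-elim)
open import Data.List using ([]; _++_; _∷ʳ_)
open import Data.List.Properties using (++-assoc; ∷-injective; ∷-injectiveʳ; ∷ʳ-++; length-++-≤ʳ)
open import Data.List.Membership.Propositional using (_∈_; lose)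
open import Data.List.Relation.Unary.All using (All; []; _∷_)
import Data.List.Relation.Unary.All.Properties as All
open import Data.List.Relation.Unary.AllPairs using (AllPairs; []; _∷_)
open import Data.List.Relation.Unary.Any using (Any; here; there)
open import Data.List.Relation.Unary.Linked using (Linked; []; [-]; _∷_)
open import Data.List.Relation.Unary.Unique.Propositional using (Unique)
open import Data.Nat using (_≤_)
open import Data.Nat.Induction using (<-wellFounded)
open import Data.Product using (_,_)
open import Data.Sum using (_⊎_; inj₁; inj₂)
open import Data.Unit.Polymorphic using (tt)
open import Induction.WellFounded using (Acc; acc)
open import Relation.Binary.Core using (Rel)
open import Relation.Binary.Definitions using (tri<; tri≈; tri>)
open import Relation.Binary.Structures using (IsStrictTotalOrder)
open import Relation.Binary.PropositionalEquality
  using (_≢_; refl; sym; cong; subst; module ≡-Reasoning)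

module _ {a ℓ} {A : Set a} {R : Rel A ℓ} where

  linked-++⁻ˡ : ∀ xs {ys} → Linked R (xs ++ ys) → Linked R xs
  linked-++⁻ˡ []           _       = []
  linked-++⁻ˡ (x ∷ [])     _       = [-]
  linked-++⁻ˡ (x ∷ y ∷ xs) (r ∷ l) = r ∷ linked-++⁻ˡ (y ∷ xs) l

  linked-++⁻ʳ : ∀ xs {ys} → Linked R (xs ++ ys) → Linked R ys
  linked-++⁻ʳ []           l       = l
  linked-++⁻ʳ (x ∷ [])     {[]} _  = []
  linked-++⁻ʳ (x ∷ [])     (_ ∷ l) = l
  linked-++⁻ʳ (x ∷ y ∷ xs) (_ ∷ l) = linked-++⁻ʳ (y ∷ xs) l

  allPairs-++⁻ˡ : ∀ xs {ys} → AllPairs R (xs ++ ys) → AllPairs R xs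
  allPairs-++⁻ˡ []       _          = []
  allPairs-++⁻ˡ (x ∷ xs) (rx ∷ rxs) = All.++⁻ˡ xs rx ∷ allPairs-++⁻ˡ xs rxs

  allPairs-++⁻ʳ : ∀ xs {ys} → AllPairs R (xs ++ ys) → AllPairs R ys
  allPairs-++⁻ʳ []       rxs       = rxs
  allPairs-++⁻ʳ (x ∷ xs) (_ ∷ rxs) = allPairs-++⁻ʳ xs rxs

∷ʳ-++-≢-[] : ∀ {a} {A : Set a} (xs : List A) {x ys} → xs ∷ʳ x ++ ys ≢ []
∷ʳ-++-≢-[] []      ()
∷ʳ-++-≢-[] (_ ∷ _) ()

module DescentDecomposition {a ℓ} {A : Set a} {_≺_ : Rel A ℓ}
                            (isStrictTotalOrder : IsStrictTotalOrder _≡_ _≺_) where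
  open IsStrictTotalOrder isStrictTotalOrder using (compare; asym)

  data Descents : A → List (List A) → Set (a ⊔ ℓ) where
    []      : ∀ {s} → Descents s []
    descent : ∀ {s P x τs} → All (s ≺_) P → x ≺ s → Descents x τs →
              Descents s ((P ∷ʳ x) ∷ τs)

  descent-++-injective : ∀ {s x x′ ws ws′} P P′ → All (s ≺_) P → x ≺ s →
                         All (s ≺_) P′ → x′ ≺ s → P ∷ʳ x ++ ws ≡ P′ ∷ʳ x′ ++ ws′ →
                         P ≡ P′ × x ≡ x′ × ws ≡ ws′
  descent-++-injective [] [] _ _ _ _ eq with refl , ws≡ws′ ← ∷-injective eq = refl , refl , ws≡ws′
  descent-++-injective [] (_ ∷ _) _ x≺s (s≺x ∷ _) _ eq with refl , _ ← ∷-injective eq =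
    ⊥-elim (asym x≺s s≺x)
  descent-++-injective (_ ∷ _) [] (s≺x′ ∷ _) _ _ x′≺s eq with refl , _ ← ∷-injective eq =
    ⊥-elim (asym x′≺s s≺x′)
  descent-++-injective (_ ∷ P) (_ ∷ P′) (_ ∷ s≺P) x≺s (_ ∷ s≺P′) x′≺s eq
    with refl , eq′ ← ∷-injective eq
    with refl , refl , ws≡ws′ ← descent-++-injective P P′ s≺P x≺s s≺P′ x′≺s eq′ =
    refl , refl , ws≡ws′

  descents-unique : ∀ {s σs τs} → Descents s σs → Descents s τs → concat σs ≡ concat τs → σs ≡ τs
  descents-unique [] [] _ = refl
  descents-unique [] (descent {P = P} _ _ _) eq = ⊥-elim (∷ʳ-++-≢-[] P (sym eq))
  descents-unique (descent {P = P} _ _ _) [] eq = ⊥-elim (∷ʳ-++-≢-[] P eq)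
  descents-unique (descent {P = P} s≺P x≺s σ) (descent {P = P′} s≺P′ x′≺s τ) eq
    with refl , refl , eq′ ← descent-++-injective P P′ s≺P x≺s s≺P′ x′≺s eq =
    cong (_ ∷_) (descents-unique σ τ eq′)

  data EndsAtMinimum (v : A) : List A → Set (a ⊔ ℓ) where
    end : EndsAtMinimum v (v ∷ [])
    _∷_ : ∀ {s w ws} → v ≺ s → EndsAtMinimum v (w ∷ ws) → EndsAtMinimum v (s ∷ w ∷ ws)

  ∷ʳ⁺ : ∀ {v init} → All (v ≺_) init → EndsAtMinimum v (init ∷ʳ v)
  ∷ʳ⁺ []                     = end
  ∷ʳ⁺ (v≺s ∷ [])             = v≺s ∷ end
  ∷ʳ⁺ (v≺s ∷ v≺init@(_ ∷ _)) = v≺s ∷ ∷ʳ⁺ v≺init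

  ++⁻ʳ : ∀ {v} xs {w ws} → EndsAtMinimum v (xs ++ w ∷ ws) → EndsAtMinimum v (w ∷ ws)
  ++⁻ʳ []           m       = m
  ++⁻ʳ (_ ∷ [])     (_ ∷ m) = m
  ++⁻ʳ (_ ∷ y ∷ xs) (_ ∷ m) = ++⁻ʳ (y ∷ xs) m

  last∈ : ∀ {v ws} → EndsAtMinimum v ws → v ∈ ws
  last∈ end     = here refl
  last∈ (_ ∷ m) = there (last∈ m)

  ≡[]⊎any-below : ∀ {v s R} → EndsAtMinimum v (s ∷ R) → R ≡ [] ⊎ Any (_≺ s) R
  ≡[]⊎any-below end       = inj₁ refl
  ≡[]⊎any-below (v≺s ∷ m) = inj₂ (lose (last∈ m) v≺s)

  splitAtFirstBelow : ∀ {s} R → All (s ≢_) R → Any (_≺ s) R →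
                      ∃[ P ] ∃[ x ] ∃[ R′ ] R ≡ P ++ x ∷ R′ × All (s ≺_) P × x ≺ s
  splitAtFirstBelow {s} (w ∷ R) (s≢w ∷ s∉R) below with compare w s | below
  ... | tri< w≺s _ _ | _          = [] , w , R , refl , [] , w≺s
  ... | tri≈ _ w≡s _ | _          = ⊥-elim (s≢w (sym w≡s))
  ... | tri> _ _ s≺w | here w≺s   = ⊥-elim (asym w≺s s≺w)
  ... | tri> _ _ s≺w | there below′
    with P , x , R′ , refl , s≺P , x≺s ← splitAtFirstBelow R s∉R below′ =
    w ∷ P , x , R′ , refl , s≺w ∷ s≺P , x≺s

  decompose-acc : ∀ {v s} R → Unique (s ∷ R) → EndsAtMinimum v (s ∷ R) → Acc _<_ (length R) →
                  ∃[ τs ] Descents s τs × concat τs ≡ R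
  decompose-acc R unique@(s∉R ∷ _) m (acc rs) with ≡[]⊎any-below m
  ... | inj₁ refl  = [] , [] , refl
  ... | inj₂ below
    with P , x , R′ , refl , s≺P , x≺s ← splitAtFirstBelow R s∉R below
    with τs , τ , refl ← decompose-acc R′ (allPairs-++⁻ʳ (_ ∷ P) unique) (++⁻ʳ (_ ∷ P) m)
                                       (rs (length-++-≤ʳ (x ∷ R′) {P})) =
    (P ∷ʳ x) ∷ τs , descent s≺P x≺s τ , ∷ʳ-++ P x (concat τs)

  decompose : ∀ {v s} R → Unique (s ∷ R) → EndsAtMinimum v (s ∷ R) →
              ∃[ τs ] Descents s τs × concat τs ≡ R
  decompose R unique m = decompose-acc R unique m (<-wellFounded (length R))

module _ {a ℓ₁ ℓ₂} (𝔾 : OrderedGraph a ℓ₁ ℓ₂) where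
  open OrderedGraph 𝔾 renaming (_<_ to _≺_)
  open DescentDecomposition <-isStrictTotalOrder

  segment-isPath : ∀ {ws L} → Segment 𝔾 ws L → IsPath 𝔾 L → IsPath 𝔾 ws
  segment-isPath {ws} (α , _ , refl) (linked , unique) =
    linked-++⁻ˡ ws (linked-++⁻ʳ α linked) , allPairs-++⁻ˡ ws (allPairs-++⁻ʳ α unique)

  lastOf-∷ʳ : ∀ s P x → lastOf 𝔾 s (P ∷ʳ x) ≡ x
  lastOf-∷ʳ s []      x = refl
  lastOf-∷ʳ s (p ∷ P) x = lastOf-∷ʳ p P x

  admSeq⇒descents : ∀ {r s} τs → AdmSeq 𝔾 r s τs → Descents s τs
  admSeq⇒descents []       _ = []
  admSeq⇒descents {r} {s} (_ ∷ τs) (((_ , P , x , refl , _ , x≺s , s≺P) , _) , seq) =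
    descent s≺P x≺s (admSeq⇒descents τs (subst (λ y → AdmSeq 𝔾 r y τs) (lastOf-∷ʳ s P x) seq))

  module _ {r L} (path : IsPath 𝔾 L)
           (short : ∀ qs → Subpath 𝔾 qs L → Admissible 𝔾 qs → length qs ≤ suc r) where

    descents⇒admSeq : ∀ α {s τs} → L ≡ α ++ s ∷ concat τs → Descents s τs → AdmSeq 𝔾 r s τs
    descents⇒admSeq α eq [] = tt
    descents⇒admSeq α {s} eq (descent {P = P} {x} {τs} s≺P x≺s τ) =
      (admissible , short _ (inj₁ segment) admissible) ,
      subst (λ y → AdmSeq 𝔾 r y τs) (sym (lastOf-∷ʳ s P x)) (descents⇒admSeq (α ++ s ∷ P) eq′ τ)
      where
        segment : Segment 𝔾 (s ∷ P ∷ʳ x) L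
        segment = α , concat τs , eq

        admissible : Admissible 𝔾 (s ∷ P ∷ʳ x)
        admissible = s , P , x , refl , segment-isPath segment path , x≺s , s≺P

        open ≡-Reasoning
        eq′ : L ≡ (α ++ s ∷ P) ++ x ∷ concat τs
        eq′ = begin
          L                                    ≡⟨ eq ⟩
          α ++ s ∷ (P ∷ʳ x ++ concat τs)       ≡⟨ cong (λ ys → α ++ s ∷ ys) (∷ʳ-++ P x (concat τs)) ⟩
          α ++ (s ∷ P) ++ x ∷ concat τs        ≡⟨ sym (++-assoc α (s ∷ P) (x ∷ concat τs)) ⟩
          (α ++ s ∷ P) ++ x ∷ concat τs        ∎

  rChain⇒descents : ∀ {r u v L} → RChain 𝔾 r u v L → ∃[ τs ] Descents u τs × u ∷ concat τs ≡ L
  rChain⇒descents (((_ , unique) , _ , L≡init∷ʳv , v≺init , ys , refl) , _)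
    with τs , τ , refl ← decompose ys unique (subst (EndsAtMinimum _) (sym L≡init∷ʳv) (∷ʳ⁺ v≺init)) =
    τs , τ , refl

  admSeq-unique : ∀ {r s σs τs} → AdmSeq 𝔾 r s σs → Descents s τs → concat σs ≡ concat τs → σs ≡ τs
  admSeq-unique {σs = σs} seq = descents-unique (admSeq⇒descents σs seq)

proposition3 : ∀ {a ℓ₁ ℓ₂} (𝔾 : OrderedGraph a ℓ₁ ℓ₂) (r : ℕ) → 1 < r →
    (u v : OrderedGraph.V 𝔾) (L : List (OrderedGraph.V 𝔾)) (t : ℕ) →
    RChain 𝔾 r u v L → length L ≡ suc t →
    ∃[ τs ] ((AdmSeq 𝔾 r u τs × u ∷ concat τs ≡ L)
    × (∀ σs → AdmSeq 𝔾 r u σs → u ∷ concat σs ≡ L → σs ≡ τs))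
proposition3 𝔾 r _ u v L _ chain@((path , _) , short) _
  with τs , τ , refl ← rChain⇒descents 𝔾 chain =
  τs , (descents⇒admSeq 𝔾 path short [] refl τ , refl) ,
  λ σs seq eq → admSeq-unique 𝔾 seq τ (∷-injectiveʳ eq)
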